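{- Let $G=(V,E)$ be a finite bipartite graph with bipartition $V=U\cup W$. For every $\mathbf{I}\in\{0,1\}^{\vec E}$ with $\mathbf{I}=\mathcal{P}_G(\mathcal{P}_G(\mathbf{I}))$, the set $V(\mathbf{I})$ is a vertex cover of $G$.
   Context: $\vec E$ is the set of directed edges, $\partial u$ the set of neighbours of $u$. $\mathcal{P}_G:\{0,1\}^{\vec E}\to\{0,1\}^{\vec E}$, $\mathcal{P}_G(\mathbf{I})_{u\to v}=\mathbf{1}\big(\sum_{w\in\partial u\setminus v}I_{w\to u}=0\big)$ (empty sum $=0$). $V(\mathbf{I})\subseteq V$: for $u\in U$, $u\in V(\mathbf{I})$ iff $\sum_{v\in\partial u}I_{v\to u}\ge1$; for $w\in W$, $w\in V(\mathbf{I})$ iff $\sum_{v\in\partial w}\mathcal{P}_G(\mathbf{I})_{v\to w}\ge2$. -}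

module Defs where

open import Data.Nat using (ℕ; _≤_; _≡ᵇ_)
open import Data.Bool using (Bool; true; false; if_then_else_; _∧_; not)
open import Data.Fin using (Fin; _≟_)
open import Data.List using (List; map; allFin)
open import Data.Nat.ListAction using (sum)
open import Relation.Nullary.Decidable using (⌊_⌋)
open import Relation.Binary.PropositionalEquality using (_≡_; _≢_)
open import Data.Sum using (_⊎_)

-- A finite simple bipartite graph on vertex set Fin n.
-- adj u v = true  iff  {u,v} ∈ E.  side u = false means u ∈ U, side u = true means u ∈ W.
record BipGraph : Set where
  field
    n      : ℕ
    adj    : Fin n → Fin n → Bool
    sym    : ∀ u v → adj u v ≡ adj v u
    irrefl : ∀ u → adj u u ≡ false
    side   : Fin n → Bool
    bip    : ∀ u v → adj u v ≡ true → side u ≢ side v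

open BipGraph public

-- A message configuration I ∈ {0,1}^{E⃗}: Msg G u v stands for I_{u→v}.
-- Values on non-edges (adj u v = false) are irrelevant: nothing below reads them,
-- and the fixed-point hypothesis only constrains directed edges.
Msg : BipGraph → Set
Msg G = Fin (n G) → Fin (n G) → Bool

b2n : Bool → ℕ
b2n true  = 1
b2n false = 0

Σ[_] : ∀ {m} → (Fin m → ℕ) → ℕ
Σ[_] {m} f = sum (map f (allFin m))

𝒫 : (G : BipGraph) → Msg G → Msg G
𝒫 G I u v = Σ[ (λ w → b2n (adj G w u ∧ not ⌊ w ≟ v ⌋ ∧ I w u)) ] ≡ᵇ 0

inV : (G : BipGraph) → Msg G → Fin (n G) → Set
inV G I u with side G u
... | false = 1 ≤ Σ[ (λ v → b2n (adj G v u ∧ I v u)) ]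
... | true  = 2 ≤ Σ[ (λ v → b2n (adj G v u ∧ 𝒫 G I v u)) ]

IsVertexCover : (G : BipGraph) → (Fin (n G) → Set) → Set
IsVertexCover G S = ∀ u v → adj G u v ≡ true → S u ⊎ S v

FixedPP : (G : BipGraph) → Msg G → Set
FixedPP G I = ∀ u v → adj G u v ≡ true → I u v ≡ 𝒫 G (𝒫 G I) u v

module Submission where

-- Let {u,w} be an edge with u ∈ U and w ∈ W, and suppose u ∉ V(I),
-- i.e. u receives no message: I_{v→u} = 0 for every neighbour v of u.  Then
--   * u sends 𝒫(I)_{u→w} = 1, since the sum defining it is a sub-sum of zeros;
--   * I_{w→u} = 0, so by the fixed-point equation 𝒫(𝒫(I))_{w→u} = 0, i.e. some
--     neighbour x ≠ u of w sends 𝒫(I)_{x→w} = 1.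
-- Hence w receives 𝒫(I)-messages from two distinct neighbours u and x, so w ∈ V(I).
--
-- The theorem follows by orienting each edge from U to W.

open import Defs hiding (sym)
open import Data.Nat using (ℕ; zero; suc; _+_; _≤_; _≤?_; z≤n; s≤s; _≡ᵇ_)
open import Data.Nat.Properties
  using (≤-trans; m≤m+n; m≤n+m; +-mono-≤; +-monoʳ-≤; +-comm; n≤0⇒n≡0; ≰⇒>; n<1⇒n≡0)
  renaming (_≟_ to _≟ℕ_)
open import Data.Bool using (true; false; _∧_; not)
open import Data.Fin using (Fin; _≟_) renaming (zero to fzero; suc to fsuc)
open import Data.List.Properties using (map-tabulate)
open import Data.Nat.ListAction using (sum)
open import Data.Product using (∃; _×_; _,_)
open import Data.Sum using (_⊎_; inj₁; inj₂; swap)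
open import Function using (id; _∘_)
open import Relation.Nullary using (yes; no; contradiction)
open import Relation.Nullary.Decidable using (⌊_⌋)
open import Relation.Binary.PropositionalEquality
  using (_≡_; _≢_; refl; sym; trans; cong; cong₂; subst; subst₂)

Σ-suc : ∀ {m} (f : Fin (suc m) → ℕ) → Σ[ f ] ≡ f fzero + Σ[ f ∘ fsuc ]
Σ-suc f = cong (λ xs → f fzero + sum xs)
               (trans (map-tabulate fsuc f) (sym (map-tabulate id (f ∘ fsuc))))

term≤Σ : ∀ {m} (f : Fin m → ℕ) (x : Fin m) → f x ≤ Σ[ f ]
term≤Σ f fzero    = subst (f fzero ≤_) (sym (Σ-suc f)) (m≤m+n _ _)
term≤Σ f (fsuc x) = subst (f (fsuc x) ≤_) (sym (Σ-suc f))
                          (≤-trans (term≤Σ (f ∘ fsuc) x) (m≤n+m _ _))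

Σ-mono : ∀ {m} (f g : Fin m → ℕ) → (∀ x → f x ≤ g x) → Σ[ f ] ≤ Σ[ g ]
Σ-mono {zero}  f g f≤g = z≤n
Σ-mono {suc m} f g f≤g =
  subst₂ _≤_ (sym (Σ-suc f)) (sym (Σ-suc g))
         (+-mono-≤ (f≤g fzero) (Σ-mono (f ∘ fsuc) (g ∘ fsuc) (f≤g ∘ fsuc)))

pair≤Σ : ∀ {m} (f : Fin m → ℕ) (x y : Fin m) → x ≢ y → f x + f y ≤ Σ[ f ]
pair≤Σ f fzero    fzero    x≢y = contradiction refl x≢y
pair≤Σ f fzero    (fsuc y) x≢y =
  subst (f fzero + f (fsuc y) ≤_) (sym (Σ-suc f)) (+-monoʳ-≤ (f fzero) (term≤Σ (f ∘ fsuc) y))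
pair≤Σ f (fsuc x) fzero    x≢y =
  subst₂ _≤_ (+-comm (f fzero) (f (fsuc x))) refl (pair≤Σ f fzero (fsuc x) (λ ()))
pair≤Σ f (fsuc x) (fsuc y) x≢y =
  subst (f (fsuc x) + f (fsuc y) ≤_) (sym (Σ-suc f))
        (≤-trans (pair≤Σ (f ∘ fsuc) x y (x≢y ∘ cong fsuc)) (m≤n+m _ _))

Σ≢0⇒term≢0 : ∀ {m} (f : Fin m → ℕ) → Σ[ f ] ≢ 0 → ∃ λ x → f x ≢ 0
Σ≢0⇒term≢0 {zero}  f Σ≢0 = contradiction refl Σ≢0
Σ≢0⇒term≢0 {suc m} f Σ≢0 with f fzero ≟ℕ 0
... | no  f₀≢0 = fzero , f₀≢0
... | yes f₀≡0 with Σ≢0⇒term≢0 (f ∘ fsuc) (λ rest≡0 → Σ≢0 (trans (Σ-suc f) (cong₂ _+_ f₀≡0 rest≡0)))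
...   | x , fx≢0 = fsuc x , fx≢0

b2n-∧-drop : ∀ a b c → b2n (a ∧ b ∧ c) ≤ b2n (a ∧ c)
b2n-∧-drop false b     c     = z≤n
b2n-∧-drop true  false c     = z≤n
b2n-∧-drop true  true  false = z≤n
b2n-∧-drop true  true  true  = s≤s z≤n

excluded-term : ∀ {m} a (x v : Fin m) c → b2n (a ∧ not ⌊ x ≟ v ⌋ ∧ c) ≢ 0 →
                a ≡ true × x ≢ v × c ≡ true
excluded-term false x v c t≢0 = contradiction refl t≢0
excluded-term true  x v c t≢0 with x ≟ v | c
... | yes _   | _     = contradiction refl t≢0
... | no  x≢v | false = contradiction refl t≢0
... | no  x≢v | true  = refl , x≢v , refl

module _ (G : BipGraph) where

  received : Msg G → Fin (n G) → ℕ
  received J u = Σ[ (λ v → b2n (adj G v u ∧ J v u)) ]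

  receivedExcept : Msg G → Fin (n G) → Fin (n G) → ℕ
  receivedExcept J u v = Σ[ (λ w → b2n (adj G w u ∧ not ⌊ w ≟ v ⌋ ∧ J w u)) ]

  quiet⇒𝒫-true : ∀ J u v → receivedExcept J u v ≡ 0 → 𝒫 G J u v ≡ true
  quiet⇒𝒫-true J u v quiet = subst (λ s → (s ≡ᵇ 0) ≡ true) (sym quiet) refl

  silent⇒𝒫-true : ∀ J u v → received J u ≡ 0 → 𝒫 G J u v ≡ true
  silent⇒𝒫-true J u v silent = quiet⇒𝒫-true J u v
    (n≤0⇒n≡0 (subst (receivedExcept J u v ≤_) silent
                    (Σ-mono _ _ (λ w → b2n-∧-drop (adj G w u) _ (J w u)))))

  𝒫-false⇒sender : ∀ J u v → 𝒫 G J u v ≡ false →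
                   ∃ λ x → adj G x u ≡ true × x ≢ v × J x u ≡ true
  𝒫-false⇒sender J u v 𝒫≡false with Σ≢0⇒term≢0 _ excluded≢0
    where
    excluded≢0 : receivedExcept J u v ≢ 0
    excluded≢0 excluded≡0 = contradiction (trans (sym 𝒫≡false) (quiet⇒𝒫-true J u v excluded≡0)) (λ ())
  ... | x , t≢0 = x , excluded-term (adj G x u) x v (J x u) t≢0

  -- The heart of the argument: at a fixed point of 𝒫∘𝒫, if one endpoint u of an edge
  -- u–w receives no message under I, then w receives two messages under 𝒫(I),
  -- namely from u itself and from the neighbour responsible for I_{w→u} = 0.
  silent⇒partner-doubly-active : ∀ I → FixedPP G I → ∀ u w → adj G u w ≡ true →
                                 received I u ≡ 0 → 2 ≤ received (𝒫 G I) w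
  silent⇒partner-doubly-active I fp u w u~w silent
    with 𝒫-false⇒sender (𝒫 G I) w u (trans (sym (fp w u w~u)) Iwu≡false)
    where
    w~u : adj G w u ≡ true
    w~u = trans (BipGraph.sym G w u) u~w
    Iwu≡false : I w u ≡ false
    Iwu≡false with I w u in Iwu
    ... | false = refl
    ... | true  = contradiction
      (n≤0⇒n≡0 (subst (b2n (adj G w u ∧ I w u) ≤_) silent (term≤Σ _ w)))
      (subst (λ t → b2n t ≢ 0) (sym (cong₂ _∧_ w~u Iwu)) (λ ()))
  ... | x , x~w , x≢u , 𝒫xw =
    ≤-trans (+-mono-≤ (indicator x~w 𝒫xw) (indicator u~w (silent⇒𝒫-true I u w silent)))
            (pair≤Σ _ x u x≢u)
    where
    indicator : ∀ {a b} → a ≡ true → b ≡ true → 1 ≤ b2n (a ∧ b)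
    indicator refl refl = s≤s z≤n

  edge-covered : ∀ I → FixedPP G I → ∀ u w → adj G u w ≡ true →
                 1 ≤ received I u ⊎ 2 ≤ received (𝒫 G I) w
  edge-covered I fp u w u~w with 1 ≤? received I u
  ... | yes active  = inj₁ active
  ... | no ¬active = inj₂ (silent⇒partner-doubly-active I fp u w u~w (n<1⇒n≡0 (≰⇒> ¬active)))

lemma5 : (G : BipGraph) (I : Msg G) → FixedPP G I → IsVertexCover G (inV G I)
lemma5 G I fp a b a~b with side G a in sa | side G b in sb
... | false | true  = edge-covered G I fp a b a~b
... | true  | false = swap (edge-covered G I fp b a (trans (BipGraph.sym G b a) a~b))
... | false | false = contradiction (trans sa (sym sb)) (bip G a b a~b)
... | true  | true  = contradiction (trans sa (sym sb)) (bip G a b a~b)
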